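{- Let $\mathfrak{A}\in\mathrm{REL}$ be a perfect algebra and $a$ an atom of $\mathfrak{A}$. (1) If $1';a\neq0$, then there is a unique atom $a^-$ of $\mathfrak{A}$ such that $a^-\le 1'$ and $a^-;a=a$. (2) If $a;1'\neq0$, then there is a unique atom $a^-$ of $\mathfrak{A}$ such that $a^-\le1'$ and $a;a^-=a$.
   Context: $\mathrm{REL}$ is the class of algebras $\mathfrak{A}=\langle A,+,\cdot,-,0,1,;,\breve{\ },1'\rangle$ (binary $;$, unary converse $x\mapsto\breve{x}$, constant $1'$) satisfying: (Ax1) $\langle A,+,\cdot,-,0,1\rangle$ is a Boolean algebra; (Ax2) $(x\cdot\breve{y})\breve{}=\breve{x}\cdot y$; (Ax3) $(x+y);z=x;z+y;z$ and $x;(y+z)=x;y+x;z$; (Ax4) $1;0=0$ and $0;1=0$; (Ax5) $(\breve{x};y)\cdot z=(\breve{x};(y\cdot(\breve{\breve{x}};z)))\cdot z$ and $(x;\breve{y})\cdot z=((x\cdot(z;\breve{\breve{y}}));\breve{y})\cdot z$; (Ax6) $1';x\le x$ and $x;1'\le x$; (Ax7) $1';1'=1'$; (Ax8) $(-(\breve{1});-(\breve{1}))\cdot 1'=0$; (Ax9) $((x\cdot1');y);z=(x\cdot1');(y;z)$, $(x;(y\cdot1'));z=x;((y\cdot1');z)$ and $(x;y);(z\cdot1')=x;(y;(z\cdot1'))$. An algebra $\mathfrak{A}\in\mathrm{REL}$ is perfect if it is complete and atomic and its converse and composition operations are completely additive. -}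

module Defs where

open import Level using (Level; _⊔_) renaming (suc to lsuc)
open import Algebra.Core using (Op₁; Op₂)
open import Algebra.Definitions using (Congruent₁; Congruent₂)
open import Algebra.Lattice.Structures using (IsBooleanAlgebra)
open import Relation.Binary.Core using (Rel)
open import Relation.Nullary using (¬_)
open import Data.Product using (Σ; ∃; _×_)

-- An algebra ⟨A,+,·,-,0,1,;,˘,1'⟩ in REL.  Equality is a setoid equality ≈
-- (all operations are required to respect it).  + is _∨_, · is _∧_,
-- complement - is ∁, 0 is 𝟘, 1 is 𝟙.
record REL (c ℓ : Level) : Set (lsuc (c ⊔ ℓ)) where
  infix  8 ∁_
  infixr 7 _∧_
  infixr 6 _∨_
  infix  4 _≈_
  infixl 9 _˘
  infixr 8 _⨾_
  field
    Carrier : Set c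
    _≈_     : Rel Carrier ℓ
    _∨_     : Op₂ Carrier
    _∧_     : Op₂ Carrier
    ∁_      : Op₁ Carrier
    𝟙       : Carrier
    𝟘       : Carrier
    _⨾_     : Op₂ Carrier
    _˘      : Op₁ Carrier
    1'      : Carrier
    isBooleanAlgebra : IsBooleanAlgebra _≈_ _∨_ _∧_ ∁_ 𝟙 𝟘
    ⨾-cong : Congruent₂ _≈_ _⨾_
    ˘-cong : Congruent₁ _≈_ _˘
    ax2 : ∀ x y → (x ∧ y ˘) ˘ ≈ x ˘ ∧ y
    ax3ʳ : ∀ x y z → (x ∨ y) ⨾ z ≈ x ⨾ z ∨ y ⨾ z
    ax3ˡ : ∀ x y z → x ⨾ (y ∨ z) ≈ x ⨾ y ∨ x ⨾ z
    ax4ˡ : 𝟙 ⨾ 𝟘 ≈ 𝟘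
    ax4ʳ : 𝟘 ⨾ 𝟙 ≈ 𝟘
    ax5ˡ : ∀ x y z → (x ˘ ⨾ y) ∧ z ≈ (x ˘ ⨾ (y ∧ (x ˘ ˘ ⨾ z))) ∧ z
    ax5ʳ : ∀ x y z → (x ⨾ y ˘) ∧ z ≈ ((x ∧ (z ⨾ y ˘ ˘)) ⨾ y ˘) ∧ z
    -- (Ax6)  (x ≤ y means x · y = x)
    ax6ˡ : ∀ x → (1' ⨾ x) ∧ x ≈ 1' ⨾ x
    ax6ʳ : ∀ x → (x ⨾ 1') ∧ x ≈ x ⨾ 1'
    ax7 : 1' ⨾ 1' ≈ 1'
    ax8 : ((∁ (𝟙 ˘)) ⨾ (∁ (𝟙 ˘))) ∧ 1' ≈ 𝟘
    ax9a : ∀ x y z → ((x ∧ 1') ⨾ y) ⨾ z ≈ (x ∧ 1') ⨾ (y ⨾ z)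
    ax9b : ∀ x y z → (x ⨾ (y ∧ 1')) ⨾ z ≈ x ⨾ ((y ∧ 1') ⨾ z)
    ax9c : ∀ x y z → (x ⨾ y) ⨾ (z ∧ 1') ≈ x ⨾ (y ⨾ (z ∧ 1'))

module _ {c ℓ : Level} (𝔄 : REL c ℓ) where
  open REL 𝔄

  _≤_ : Carrier → Carrier → Set ℓ
  x ≤ y = x ∧ y ≈ x

  Subset : Set (lsuc (c ⊔ ℓ))
  Subset = Carrier → Set (c ⊔ ℓ)

  IsJoin : Subset → Carrier → Set (lsuc (c ⊔ ℓ))
  IsJoin S s = Lift′ ((∀ x → S x → x ≤ s) × (∀ u → (∀ x → S x → x ≤ u) → s ≤ u))
    where
      Lift′ : Set (c ⊔ ℓ) → Set (lsuc (c ⊔ ℓ))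
      Lift′ = Level.Lift (lsuc (c ⊔ ℓ))

  Image : (Carrier → Carrier) → Subset → Subset
  Image f S y = ∃ λ x → S x × (y ≈ f x)

  IsAtom : Carrier → Set (c ⊔ ℓ)
  IsAtom a = (¬ (a ≈ 𝟘)) × (∀ x → x ≤ a → (x ≈ 𝟘) Data.Sum.⊎ (x ≈ a))
    where import Data.Sum

  IsComplete : Set (lsuc (c ⊔ ℓ))
  IsComplete = ∀ (S : Subset) → Σ Carrier (IsJoin S)

  IsAtomic : Set (c ⊔ ℓ)
  IsAtomic = ∀ x → ¬ (x ≈ 𝟘) → Σ Carrier λ a → IsAtom a × (a ≤ x)

  CompletelyAdditive₁ : (Carrier → Carrier) → Set (lsuc (c ⊔ ℓ))
  CompletelyAdditive₁ f = ∀ (S : Subset) s → IsJoin S s → IsJoin (Image f S) (f s)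

  IsPerfect : Set (lsuc (c ⊔ ℓ))
  IsPerfect = IsComplete × IsAtomic
            × CompletelyAdditive₁ _˘
            × (∀ z → CompletelyAdditive₁ (λ x → x ⨾ z))
            × (∀ z → CompletelyAdditive₁ (λ x → z ⨾ x))

-- Let F be x ↦ x ; a (resp. a ; x).  F is completely additive, and F 1' ≤ a by (Ax6).  In an
-- atomic complete algebra 1' lies below the join of the atoms under it, so F 1' ≤ ⋁ F e over
-- those atoms e; each F e ≤ a is 0 or a, hence F 1' ≠ 0 forces F e = a for some e.  Uniqueness:
-- two distinct subidentity atoms are disjoint, so their composite is 0 and (Ax9) would give
-- a = e ; (e' ; a) = (e ; e') ; a = 0.
module Submission where

open import Defs hiding (_≤_)
open import Level using (Level; lower)
open import Relation.Nullary using (¬_)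
open import Data.Product using (Σ; _×_; _,_; proj₁; proj₂)
open import Data.Sum using (_⊎_; inj₁; inj₂)
open import Data.Empty using (⊥-elim)
open import Algebra.Lattice.Bundles using (BooleanAlgebra)
open import Algebra.Lattice.Structures using (IsBooleanAlgebra)
open import Algebra.Lattice.Properties.Lattice using (∨-∧-orderTheoreticLattice)
import Algebra.Lattice.Properties.BooleanAlgebra as BooleanAlgebraProperties
import Relation.Binary.Lattice.Bundles as OrderTheoretic
import Relation.Binary.Lattice.Properties.JoinSemilattice as JoinSemilatticeProperties
import Relation.Binary.Reasoning.Setoid as SetoidReasoning

module Properties {c ℓ : Level} (𝔄 : REL c ℓ) where
  open REL 𝔄
  open IsBooleanAlgebra isBooleanAlgebra

  booleanAlgebra : BooleanAlgebra c ℓ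
  booleanAlgebra = record { isBooleanAlgebra = isBooleanAlgebra }

  open BooleanAlgebra booleanAlgebra using (setoid; lattice)
  open BooleanAlgebraProperties booleanAlgebra using (∧-zeroʳ; ∧-identityʳ; ∨-identityʳ)
  open SetoidReasoning setoid

  -- The standard library orders a lattice by x ≈ x ∧ y, whereas Defs uses x ∧ y ≈ x.
  private
    module ≤ₗ = OrderTheoretic.Lattice (∨-∧-orderTheoreticLattice lattice)
    module ∨ₗ = JoinSemilatticeProperties ≤ₗ.joinSemilattice

  infix 4 _≤_
  _≤_ : Carrier → Carrier → Set ℓ
  _≤_ = Defs._≤_ 𝔄

  private variable
    a b e e' u x y z : Carrier

  ≤-reflexive : x ≈ y → x ≤ y
  ≤-reflexive p = sym (≤ₗ.reflexive p)

  ≤-trans : x ≤ y → y ≤ z → x ≤ z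
  ≤-trans p q = sym (≤ₗ.trans (sym p) (sym q))

  x∧y≤x : ∀ x y → x ∧ y ≤ x
  x∧y≤x x y = sym (≤ₗ.x∧y≤x x y)

  x∧y≤y : ∀ x y → x ∧ y ≤ y
  x∧y≤y x y = sym (≤ₗ.x∧y≤y x y)

  ∧-greatest : x ≤ y → x ≤ z → x ≤ y ∧ z
  ∧-greatest p q = sym (≤ₗ.∧-greatest (sym p) (sym q))

  x≤x∨y : ∀ x y → x ≤ x ∨ y
  x≤x∨y x y = sym (≤ₗ.x≤x∨y x y)

  x≤y⇒x∨y≈y : x ≤ y → x ∨ y ≈ y
  x≤y⇒x∨y≈y p = ∨ₗ.x≤y⇒x∨y≈y (sym p)

  x≤𝟙 : ∀ x → x ≤ 𝟙
  x≤𝟙 = ∧-identityʳ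

  x≤𝟘⇒x≈𝟘 : x ≤ 𝟘 → x ≈ 𝟘
  x≤𝟘⇒x≈𝟘 {x} p = trans (sym p) (∧-zeroʳ x)

  x∧∁y≈𝟘⇒x≤y : x ∧ ∁ y ≈ 𝟘 → x ≤ y
  x∧∁y≈𝟘⇒x≤y {x} {y} p = begin
    x ∧ y               ≈⟨ ∨-identityʳ (x ∧ y) ⟨
    x ∧ y ∨ 𝟘           ≈⟨ ∨-congˡ p ⟨
    x ∧ y ∨ x ∧ ∁ y     ≈⟨ ∧-distribˡ-∨ x y (∁ y) ⟨
    x ∧ (y ∨ ∁ y)       ≈⟨ ∧-congˡ (∨-complementʳ y) ⟩
    x ∧ 𝟙               ≈⟨ ∧-identityʳ x ⟩
    x                   ∎

  x≤y⇒x≤∁y⇒x≈𝟘 : x ≤ y → x ≤ ∁ y → x ≈ 𝟘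
  x≤y⇒x≤∁y⇒x≈𝟘 {y = y} p q =
    x≤𝟘⇒x≈𝟘 (≤-trans (∧-greatest p q) (≤-reflexive (∧-complementʳ y)))

  ⨾-monoˡ : ∀ z → x ≤ y → x ⨾ z ≤ y ⨾ z
  ⨾-monoˡ {x} {y} z p = ≤-trans (x≤x∨y (x ⨾ z) (y ⨾ z)) (≤-reflexive (begin
    x ⨾ z ∨ y ⨾ z   ≈⟨ ax3ʳ x y z ⟨
    (x ∨ y) ⨾ z     ≈⟨ ⨾-cong (x≤y⇒x∨y≈y p) refl ⟩
    y ⨾ z           ∎))

  ⨾-monoʳ : ∀ z → x ≤ y → z ⨾ x ≤ z ⨾ y
  ⨾-monoʳ {x} {y} z p = ≤-trans (x≤x∨y (z ⨾ x) (z ⨾ y)) (≤-reflexive (begin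
    z ⨾ x ∨ z ⨾ y   ≈⟨ ax3ˡ z x y ⟨
    z ⨾ (x ∨ y)     ≈⟨ ⨾-cong refl (x≤y⇒x∨y≈y p) ⟩
    z ⨾ y           ∎))

  ⨾-zeroˡ : ∀ x → 𝟘 ⨾ x ≈ 𝟘
  ⨾-zeroˡ x = x≤𝟘⇒x≈𝟘 (≤-trans (⨾-monoʳ 𝟘 (x≤𝟙 x)) (≤-reflexive ax4ʳ))

  ⨾-zeroʳ : ∀ x → x ⨾ 𝟘 ≈ 𝟘
  ⨾-zeroʳ x = x≤𝟘⇒x≈𝟘 (≤-trans (⨾-monoˡ 𝟘 (x≤𝟙 x)) (≤-reflexive ax4ˡ))

  subidentity-⨾≤∧ : e ≤ 1' → e' ≤ 1' → e ⨾ e' ≤ e ∧ e'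
  subidentity-⨾≤∧ {e} {e'} e≤1' e'≤1' = ∧-greatest
    (≤-trans (⨾-monoʳ e e'≤1') (ax6ʳ e))
    (≤-trans (⨾-monoˡ e' e≤1') (ax6ˡ e'))

  atom-≤-nonzero⇒≈ : IsAtom 𝔄 a → ¬ x ≈ 𝟘 → x ≤ a → x ≈ a
  atom-≤-nonzero⇒≈ (_ , below) x≉𝟘 x≤a with below _ x≤a
  ... | inj₁ x≈𝟘 = ⊥-elim (x≉𝟘 x≈𝟘)
  ... | inj₂ x≈a = x≈a

  atoms-meet-nonzero⇒≈ : IsAtom 𝔄 a → IsAtom 𝔄 b → ¬ a ∧ b ≈ 𝟘 → a ≈ b
  atoms-meet-nonzero⇒≈ {a} {b} a-atom b-atom a∧b≉𝟘 =
    atom-≤-nonzero⇒≈ b-atom (a-atom .proj₁)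
      (atom-≤-nonzero⇒≈ a-atom a∧b≉𝟘 (x∧y≤x a b))

  disjoint-subidentities-⨾≈𝟘 : e ≤ 1' → e' ≤ 1' → e ∧ e' ≈ 𝟘 → e ⨾ e' ≈ 𝟘
  disjoint-subidentities-⨾≈𝟘 e≤1' e'≤1' e∧e'≈𝟘 =
    x≤𝟘⇒x≈𝟘 (≤-trans (subidentity-⨾≤∧ e≤1' e'≤1') (≤-reflexive e∧e'≈𝟘))

  AtomsBelow : Carrier → Subset 𝔄
  AtomsBelow u x = IsAtom 𝔄 x × x ≤ u

  local-identityˡ-unique : IsAtom 𝔄 a → AtomsBelow 1' e × e ⨾ a ≈ a →
                           AtomsBelow 1' e' × e' ⨾ a ≈ a → e ≈ e'
  local-identityˡ-unique {a} {e} {e'} a-atom ((e-atom , e≤1') , ea≈a) ((e'-atom , e'≤1') , e'a≈a) =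
    atoms-meet-nonzero⇒≈ e-atom e'-atom λ e∧e'≈𝟘 → a-atom .proj₁ (begin
      a                     ≈⟨ ea≈a ⟨
      e ⨾ a                 ≈⟨ ⨾-cong e≤1' e'a≈a ⟨
      (e ∧ 1') ⨾ (e' ⨾ a)   ≈⟨ ax9a e e' a ⟨
      ((e ∧ 1') ⨾ e') ⨾ a   ≈⟨ ⨾-cong (⨾-cong e≤1' refl) refl ⟩
      (e ⨾ e') ⨾ a          ≈⟨ ⨾-cong (disjoint-subidentities-⨾≈𝟘 e≤1' e'≤1' e∧e'≈𝟘) refl ⟩
      𝟘 ⨾ a                 ≈⟨ ⨾-zeroˡ a ⟩
      𝟘                     ∎)

  local-identityʳ-unique : IsAtom 𝔄 a → AtomsBelow 1' e × a ⨾ e ≈ a →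
                           AtomsBelow 1' e' × a ⨾ e' ≈ a → e ≈ e'
  local-identityʳ-unique {a} {e} {e'} a-atom ((e-atom , e≤1') , ae≈a) ((e'-atom , e'≤1') , ae'≈a) =
    atoms-meet-nonzero⇒≈ e-atom e'-atom λ e∧e'≈𝟘 → a-atom .proj₁ (begin
      a                     ≈⟨ ae'≈a ⟨
      a ⨾ e'                ≈⟨ ⨾-cong ae≈a e'≤1' ⟨
      (a ⨾ e) ⨾ (e' ∧ 1')   ≈⟨ ax9c a e e' ⟩
      a ⨾ (e ⨾ (e' ∧ 1'))   ≈⟨ ⨾-cong refl (⨾-cong refl e'≤1') ⟩
      a ⨾ (e ⨾ e')          ≈⟨ ⨾-cong refl (disjoint-subidentities-⨾≈𝟘 e≤1' e'≤1' e∧e'≈𝟘) ⟩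
      a ⨾ 𝟘                 ≈⟨ ⨾-zeroʳ a ⟩
      𝟘                     ∎)

  ≤-⋁AtomsBelow : IsAtomic 𝔄 → ∀ {t} → IsJoin 𝔄 (AtomsBelow u) t → ¬ ¬ u ≤ t
  ≤-⋁AtomsBelow {u} atomic {t} t-join u≰t with atomic (u ∧ ∁ t) (λ p → u≰t (x∧∁y≈𝟘⇒x≤y p))
  ... | f , f-atom , f≤u∧∁t = f-atom .proj₁ (x≤y⇒x≤∁y⇒x≈𝟘
    (lower t-join .proj₁ f (f-atom , ≤-trans f≤u∧∁t (x∧y≤x u (∁ t))))
    (≤-trans f≤u∧∁t (x∧y≤y u (∁ t))))

  module AtomicPreimage
    (complete : IsComplete 𝔄) (atomic : IsAtomic 𝔄)
    {F : Carrier → Carrier} (F-cong : ∀ {x y} → x ≈ y → F x ≈ F y)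
    (F-mono : ∀ {x y} → x ≤ y → F x ≤ F y) (F-additive : CompletelyAdditive₁ 𝔄 F)
    (a-atom : IsAtom 𝔄 a) (Fu≤a : F u ≤ a) (Fu≉𝟘 : ¬ F u ≈ 𝟘)
    where

    Preimage : Subset 𝔄
    Preimage e = AtomsBelow u e × F e ≈ a

    F≈𝟘⊎F≈a : AtomsBelow u e → F e ≈ 𝟘 ⊎ F e ≈ a
    F≈𝟘⊎F≈a (_ , e≤u) = a-atom .proj₂ _ (≤-trans (F-mono e≤u) Fu≤a)

    preimage-nonempty : ¬ ¬ Σ Carrier Preimage
    preimage-nonempty no-preimage = ≤-⋁AtomsBelow atomic t-join λ u≤t →
      Fu≉𝟘 (x≤𝟘⇒x≈𝟘 (≤-trans (F-mono u≤t) (lower (F-additive _ _ t-join) .proj₂ 𝟘 image≤𝟘)))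
      where
      t-join : IsJoin 𝔄 (AtomsBelow u) (complete (AtomsBelow u) .proj₁)
      t-join = complete (AtomsBelow u) .proj₂

      image≤𝟘 : ∀ y → Image 𝔄 F (AtomsBelow u) y → y ≤ 𝟘
      image≤𝟘 y (e , e-below , y≈Fe) with F≈𝟘⊎F≈a e-below
      ... | inj₁ Fe≈𝟘 = ≤-reflexive (trans y≈Fe Fe≈𝟘)
      ... | inj₂ Fe≈a = ⊥-elim (no-preimage (e , e-below , Fe≈a))

    ⋁Preimage : Carrier
    ⋁Preimage = complete Preimage .proj₁

    ⋁Preimage-isJoin : IsJoin 𝔄 Preimage ⋁Preimage
    ⋁Preimage-isJoin = complete Preimage .proj₂

    ⋁Preimage≤u : ⋁Preimage ≤ u
    ⋁Preimage≤u = lower ⋁Preimage-isJoin .proj₂ u λ _ ((_ , e≤u) , _) → e≤u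

    ⋁Preimage≉𝟘 : ¬ ⋁Preimage ≈ 𝟘
    ⋁Preimage≉𝟘 ⋁≈𝟘 = preimage-nonempty λ (e , e∈@((e-atom , _) , _)) → e-atom .proj₁
      (x≤𝟘⇒x≈𝟘 (≤-trans (lower ⋁Preimage-isJoin .proj₁ e e∈) (≤-reflexive ⋁≈𝟘)))

    -- preimage-nonempty only refutes emptiness; a witness is recovered constructively as an
    -- atom below ⋁ Preimage, which uniqueness forces into the preimage.
    unique-preimage : (∀ {e e'} → Preimage e → Preimage e' → e ≈ e') →
      Σ Carrier λ e → IsAtom 𝔄 e × e ≤ u × F e ≈ a
        × (∀ b → IsAtom 𝔄 b → b ≤ u → F b ≈ a → b ≈ e)
    unique-preimage preimage-unique with atomic ⋁Preimage ⋁Preimage≉𝟘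
    ... | f , f-atom , f≤⋁ = f , f-atom , f≤u , Ff≈a , λ b b-atom b≤u Fb≈a →
      preimage-unique ((b-atom , b≤u) , Fb≈a) ((f-atom , f≤u) , Ff≈a)
      where
      f≤u : f ≤ u
      f≤u = ≤-trans f≤⋁ ⋁Preimage≤u

      f≈preimage : ∀ {e} → Preimage e → f ≈ e
      f≈preimage e∈@((e-atom , _) , _) =
        atom-≤-nonzero⇒≈ e-atom (f-atom .proj₁) (≤-trans f≤⋁ ⋁≤e)
        where
        ⋁≤e : ⋁Preimage ≤ _
        ⋁≤e = lower ⋁Preimage-isJoin .proj₂ _ λ _ e'∈ → ≤-reflexive (preimage-unique e'∈ e∈)

      Ff≈a : F f ≈ a
      Ff≈a with F≈𝟘⊎F≈a (f-atom , f≤u)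
      ... | inj₂ Ff≈a = Ff≈a
      ... | inj₁ Ff≈𝟘 = ⊥-elim (preimage-nonempty λ (e , e∈@(_ , Fe≈a)) →
        a-atom .proj₁ (trans (sym Fe≈a) (trans (F-cong (sym (f≈preimage e∈))) Ff≈𝟘)))

open import Defs using (_≤_)

lemma2p3 : ∀ {c ℓ} (𝔄 : REL c ℓ) → IsPerfect 𝔄 → ∀ a → IsAtom 𝔄 a →
    ((¬ (REL._≈_ 𝔄 (REL._⨾_ 𝔄 (REL.1' 𝔄) a) (REL.𝟘 𝔄))) →
      Σ (REL.Carrier 𝔄) λ a⁻ → IsAtom 𝔄 a⁻ × _≤_ 𝔄 a⁻ (REL.1' 𝔄)
        × REL._≈_ 𝔄 (REL._⨾_ 𝔄 a⁻ a) a
        × (∀ b → IsAtom 𝔄 b → _≤_ 𝔄 b (REL.1' 𝔄) → REL._≈_ 𝔄 (REL._⨾_ 𝔄 b a) a → REL._≈_ 𝔄 b a⁻))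
    × ((¬ (REL._≈_ 𝔄 (REL._⨾_ 𝔄 a (REL.1' 𝔄)) (REL.𝟘 𝔄))) →
      Σ (REL.Carrier 𝔄) λ a⁻ → IsAtom 𝔄 a⁻ × _≤_ 𝔄 a⁻ (REL.1' 𝔄)
        × REL._≈_ 𝔄 (REL._⨾_ 𝔄 a a⁻) a
        × (∀ b → IsAtom 𝔄 b → _≤_ 𝔄 b (REL.1' 𝔄) → REL._≈_ 𝔄 (REL._⨾_ 𝔄 a b) a → REL._≈_ 𝔄 b a⁻))
lemma2p3 𝔄 (complete , atomic , _ , ⨾-additiveˡ , ⨾-additiveʳ) a a-atom =
    (λ 1'⨾a≉𝟘 → AtomicPreimage.unique-preimage complete atomic
       (λ p → ⨾-cong p refl) (⨾-monoˡ a) (⨾-additiveˡ a) a-atom (ax6ˡ a) 1'⨾a≉𝟘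
       (local-identityˡ-unique a-atom))
  , (λ a⨾1'≉𝟘 → AtomicPreimage.unique-preimage complete atomic
       (λ p → ⨾-cong refl p) (⨾-monoʳ a) (⨾-additiveʳ a) a-atom (ax6ʳ a) a⨾1'≉𝟘
       (local-identityʳ-unique a-atom))
  where
  open REL 𝔄
  open Properties 𝔄
  open IsBooleanAlgebra isBooleanAlgebra using (refl)
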